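{- Let $s\ge 6$ be an integer. Suppose that every outerplanar graph $G'$ with $\min_{w\in V(G')}\alpha_w(G')\ge\lfloor |G'|/(s-1)\rfloor$ has an equitable $(s-1)$-coloring. Then every outerplanar graph $G$ with $\min_{x\in V(G)}\alpha_x(G)\ge\lfloor |G|/s\rfloor$ has an equitable $s$-coloring. Consequently, for each integer $s_0\ge 5$: if every outerplanar graph $G$ with $\min_{v}\alpha_v(G)\ge\lfloor |G|/s_0\rfloor$ has an equitable $s_0$-coloring, then for every integer $s\ge s_0$, every outerplanar graph $G$ with $\min_v\alpha_v(G)\ge\lfloor|G|/s\rfloor$ has an equitable $s$-coloring.
   Context: For a graph $G$ and $v\in V(G)$, $\alpha_v(G)$ is the maximum size of an independent set containing $v$. A proper coloring of an $n$-vertex graph with colors $1,\dots,k$ is equitable if every color class has size $\lfloor n/k\rfloor$ or $\lceil n/k\rceil$. -}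

module Defs where

open import Data.Nat using (ℕ; zero; suc; _+_; _∸_; _≤_; _/_)
open import Data.Bool using (Bool; true; false)
open import Data.Fin using (Fin; _<_)
open import Data.Fin.Subset using (Subset; _∈_; ∣_∣)
open import Data.Fin.Properties using (_≟_)
open import Data.Vec using (tabulate)
open import Data.Product using (Σ; _×_; ∃)
open import Relation.Nullary using (¬_; does)
open import Relation.Binary.PropositionalEquality using (_≡_; _≢_)
open import Function.Definitions using (Injective)

record Graph (n : ℕ) : Set where
  field
    adj   : Fin n → Fin n → Bool
    sym   : ∀ u v → adj u v ≡ adj v u
    irref : ∀ v → adj v v ≡ false
open Graph public

-- Outerplanar: the vertices can be placed in convex position (on a circle,
-- in the cyclic order given by the injective map pos) so that no two edges,
-- drawn as straight chords, cross; i.e. there are no vertices a,b,c,d in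
-- this order around the circle with both ac and bd edges.
Outerplanar : ∀ {n} → Graph n → Set
Outerplanar {n} G =
  Σ (Fin n → Fin n) λ pos → Injective _≡_ _≡_ pos ×
    (∀ a b c d → pos a < pos b → pos b < pos c → pos c < pos d →
      ¬ (adj G a c ≡ true × adj G b d ≡ true))

Independent : ∀ {n} → Graph n → Subset n → Set
Independent G S = ∀ u v → u ∈ S → v ∈ S → adj G u v ≡ false

-- α_v(G) ≥ k : some independent set containing v has at least k vertices
-- (α_v(G) is the maximum size of such a set, so this is the unfolding).
αAtLeast : ∀ {n} → Graph n → Fin n → ℕ → Set
αAtLeast G v k = Σ _ λ S → Independent G S × v ∈ S × k ≤ ∣ S ∣

MinαAtLeast : ∀ {n} → Graph n → ℕ → Set
MinαAtLeast {n} G k = ∀ (v : Fin n) → αAtLeast G v k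

-- floor and ceiling of n / k (conventionally 0 when k = 0; only used with k ≥ 5).
⌊_/_⌋ : ℕ → ℕ → ℕ
⌊ n / zero ⌋ = 0
⌊ n / suc k ⌋ = n / suc k

⌈_/_⌉ : ℕ → ℕ → ℕ
⌈ n / zero ⌉ = 0
⌈ n / suc k ⌉ = (n + k) / suc k

classSize : ∀ {n k} → (Fin n → Fin k) → Fin k → ℕ
classSize c i = ∣ tabulate (λ v → does (c v ≟ i)) ∣

Proper : ∀ {n k} → Graph n → (Fin n → Fin k) → Set
Proper G c = ∀ u v → adj G u v ≡ true → c u ≢ c v

HasEquitableColoring : ∀ {n} → Graph n → ℕ → Set
HasEquitableColoring {n} G k =
  Σ (Fin n → Fin k) λ c → Proper G c ×
    (∀ i → ⌊ n / k ⌋ ≤ classSize c i × classSize c i ≤ ⌈ n / k ⌉)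

Claim : ℕ → Set
Claim s = ∀ (n : ℕ) (G : Graph n) → Outerplanar G →
  MinαAtLeast G ⌊ n / s ⌋ → HasEquitableColoring G s

-- Let m = ⌊n/s⌋ and t = ⌈n/s⌉ for an outerplanar G on n vertices. It suffices to find an
-- independent set I with |I| = t such that every vertex w ∉ I lies in an independent set of
-- size m avoiding I: then G − I has n − t vertices, ⌊(n−t)/(s−1)⌋ = m and ⌈(n−t)/(s−1)⌉ ≤ t,
-- so an equitable (s−1)-coloring of G − I plus the class I is an equitable s-coloring of G.
--
-- If some vertex w₀ has degree at least 2m + 5, drop its first neighbour along the circle and
-- take every other one of the remaining neighbours: by planarity this gives two disjoint
-- independent sets A, B with at least m + 2 elements each, and we take I ⊆ A. The vertex w₀
-- keeps the independent set given by the hypothesis, which misses N(w₀) ⊇ I, and any other w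
-- uses w together with B − N[w], since w and w₀ have at most two common neighbours.
-- Otherwise all degrees are at most 2m + 4. Every nonempty vertex set U of an outerplanar graph
-- contains a vertex with at most two neighbours in U, so greedily U contains an independent set
-- of size |U|/3; this yields I, and for each w ∉ I an independent set of size m − 1 in
-- G − I − N[w]. These counts rely on n ≥ 5m + t, which is where s ≥ 6 is used.

{-# OPTIONS --safe #-}
module Submission where

open import Defs hiding (sym)
open import Data.Bool.Base using (Bool; true; false; not; _∧_; if_then_else_)
open import Data.Bool.Properties using (not-involutive; ¬-not)
open import Data.Empty using (⊥; ⊥-elim)
open import Data.Fin.Base as Fin using (Fin; zero; suc; punchOut)
open import Data.Fin.Properties as Finₚ using (<-cmp; ≤∧≢⇒<; any?)
open import Data.Fin.Permutation as Perm using (Permutation′; permutation; _⟨$⟩ʳ_; _⟨$⟩ˡ_)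
open import Data.Fin.Subset as Subset
  using (Subset; inside; outside; _∈_; _∉_; _⊆_; _∪_; _∩_; _─_; _-_; ∁; ⁅_⁆; ∣_∣; Nonempty; Empty)
open import Data.Fin.Subset.Properties
open import Data.Nat.Base as ℕ using (ℕ; zero; suc; _+_; _*_; _∸_; _/_; _%_; _≤_; _<_; z≤n; s≤s)
open import Data.Nat.DivMod using (m≡m%n+[m/n]*n; m%n<n; m*n/n≡m; m<n⇒m/n≡0; +-distrib-/-∣ʳ)
open import Data.Nat.Divisibility using (n∣m*n)
open import Data.Nat.Induction using (<-wellFounded)
open import Data.Nat.Properties as ℕₚ using (≤-trans; +-suc)
open import Data.Nat.Tactic.RingSolver using (solve-∀)
open import Data.Product using (Σ; ∃; ∃₂; _×_; _,_; proj₁; proj₂)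
open import Data.Sum using (_⊎_; inj₁; inj₂; [_,_])
open import Data.Vec.Base using ([]; _∷_; tabulate; lookup; here; there)
open import Data.Vec.Properties
  using (lookup∘tabulate; tabulate∘lookup; []=⇒lookup; lookup⇒[]=; tabulate-cong)
open import Function.Base using (_∘_; id)
open import Function.Bundles using (mk⇔)
open import Function.Definitions using (Injective)
open import Induction.WellFounded using (Acc; acc)
open import Relation.Binary.Definitions using (tri<; tri≈; tri>)
open import Relation.Binary.PropositionalEquality
  using (_≡_; _≢_; refl; sym; trans; cong; cong₂; subst; subst₂; module ≡-Reasoning)
open import Relation.Nullary using (¬_; Dec; yes; no; does; contradiction)
open import Relation.Nullary.Decidable using (dec-true; dec-false; does-⇔; _×-dec_; _⊎-dec_)

open import Algebra.Properties.CommutativeMonoid.Sum ℕₚ.+-0-commutativeMonoid using (sum; sum-permute)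

private variable
  n : ℕ

∈-tabulate⁺ : ∀ (f : Fin n → Bool) {x} → f x ≡ true → x ∈ tabulate f
∈-tabulate⁺ f {x} fx = lookup⇒[]= x (tabulate f) (trans (lookup∘tabulate f x) fx)

∈-tabulate⁻ : ∀ (f : Fin n → Bool) {x} → x ∈ tabulate f → f x ≡ true
∈-tabulate⁻ f {x} x∈ = trans (sym (lookup∘tabulate f x)) ([]=⇒lookup x∈)

x∈p─q⇒x∉q : ∀ (p q : Subset n) {x} → x ∈ p ─ q → x ∉ q
x∈p─q⇒x∉q (inside ∷ p) (outside ∷ q) here ()
x∈p─q⇒x∉q (_ ∷ p) (_ ∷ q) (there x∈p─q) (there x∈q) = x∈p─q⇒x∉q p q x∈p─q x∈q

∁-involutive : ∀ (p : Subset n) → ∁ (∁ p) ≡ p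
∁-involutive [] = refl
∁-involutive (x ∷ p) = cong₂ _∷_ (not-involutive x) (∁-involutive p)

∣p∪q∣≤∣p∣+∣q∣ : ∀ (p q : Subset n) → ∣ p ∪ q ∣ ≤ ∣ p ∣ + ∣ q ∣
∣p∪q∣≤∣p∣+∣q∣ [] [] = z≤n
∣p∪q∣≤∣p∣+∣q∣ (inside ∷ p) (inside ∷ q) =
  s≤s (≤-trans (∣p∪q∣≤∣p∣+∣q∣ p q) (ℕₚ.+-monoʳ-≤ ∣ p ∣ (ℕₚ.n≤1+n _)))
∣p∪q∣≤∣p∣+∣q∣ (inside ∷ p) (outside ∷ q) = s≤s (∣p∪q∣≤∣p∣+∣q∣ p q)
∣p∪q∣≤∣p∣+∣q∣ (outside ∷ p) (inside ∷ q) =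
  subst (_≤_ _) (sym (+-suc ∣ p ∣ ∣ q ∣)) (s≤s (∣p∪q∣≤∣p∣+∣q∣ p q))
∣p∪q∣≤∣p∣+∣q∣ (outside ∷ p) (outside ∷ q) = ∣p∪q∣≤∣p∣+∣q∣ p q

∣p∣≡∣p∩q∣+∣p─q∣ : ∀ (p q : Subset n) → ∣ p ∣ ≡ ∣ p ∩ q ∣ + ∣ p ─ q ∣
∣p∣≡∣p∩q∣+∣p─q∣ [] [] = refl
∣p∣≡∣p∩q∣+∣p─q∣ (inside ∷ p) (inside ∷ q) = cong suc (∣p∣≡∣p∩q∣+∣p─q∣ p q)
∣p∣≡∣p∩q∣+∣p─q∣ (inside ∷ p) (outside ∷ q) =
  trans (cong suc (∣p∣≡∣p∩q∣+∣p─q∣ p q)) (sym (+-suc _ _))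
∣p∣≡∣p∩q∣+∣p─q∣ (outside ∷ p) (inside ∷ q) = ∣p∣≡∣p∩q∣+∣p─q∣ p q
∣p∣≡∣p∩q∣+∣p─q∣ (outside ∷ p) (outside ∷ q) = ∣p∣≡∣p∩q∣+∣p─q∣ p q

Empty⇒∣p∣≡0 : ∀ {p : Subset n} → Empty p → ∣ p ∣ ≡ 0
Empty⇒∣p∣≡0 {n} empty = trans (cong ∣_∣ (Empty-unique empty)) (∣⊥∣≡0 n)

nonempty : ∀ {p : Subset n} → 0 < ∣ p ∣ → Nonempty p
nonempty {p = p} 0<∣p∣ with nonempty? p
... | yes ne = ne
... | no empty = contradiction (Empty⇒∣p∣≡0 empty) (ℕₚ.>⇒≢ 0<∣p∣)

∣p∩⁅x⁆∣≤1 : ∀ (p : Subset n) x → ∣ p ∩ ⁅ x ⁆ ∣ ≤ 1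
∣p∩⁅x⁆∣≤1 p x = ≤-trans (∣p∩q∣≤∣q∣ p ⁅ x ⁆) (ℕₚ.≤-reflexive (∣⁅x⁆∣≡1 x))

∣p∣≤1+∣p-x∣ : ∀ (p : Subset n) x → ∣ p ∣ ≤ suc ∣ p - x ∣
∣p∣≤1+∣p-x∣ p x = begin
  ∣ p ∣                       ≡⟨ ∣p∣≡∣p∩q∣+∣p─q∣ p ⁅ x ⁆ ⟩
  ∣ p ∩ ⁅ x ⁆ ∣ + ∣ p - x ∣   ≤⟨ ℕₚ.+-monoˡ-≤ ∣ p - x ∣ (∣p∩⁅x⁆∣≤1 p x) ⟩
  suc ∣ p - x ∣               ∎
  where open ℕₚ.≤-Reasoning

shrink : ∀ (p : Subset n) t → t ≤ ∣ p ∣ → ∃ λ q → q ⊆ p × ∣ q ∣ ≡ t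
shrink {n} p zero _ = Subset.⊥ , ⊥⊆ , ∣⊥∣≡0 n
shrink (inside ∷ p) (suc t) (s≤s t≤∣p∣) with q , q⊆p , ∣q∣≡t ← shrink p t t≤∣p∣ =
  inside ∷ q , s⊆s q⊆p , cong suc ∣q∣≡t
shrink (outside ∷ p) (suc t) t<∣p∣ with q , q⊆p , ∣q∣≡t ← shrink p (suc t) t<∣p∣ =
  outside ∷ q , s⊆s q⊆p , ∣q∣≡t

x∉p⇒∣⁅x⁆∪p∣≡1+∣p∣ : ∀ {p : Subset n} {x} → x ∉ p → ∣ ⁅ x ⁆ ∪ p ∣ ≡ suc ∣ p ∣
x∉p⇒∣⁅x⁆∪p∣≡1+∣p∣ {p = p} {x} x∉p = ℕₚ.≤-antisym
  (≤-trans (∣p∪q∣≤∣p∣+∣q∣ ⁅ x ⁆ p) (ℕₚ.≤-reflexive (cong (_+ ∣ p ∣) (∣⁅x⁆∣≡1 x))))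
  (p⊂q⇒∣p∣<∣q∣ (q⊆p∪q ⁅ x ⁆ p , x , p⊆p∪q p (x∈⁅x⁆ x) , x∉p))

minimum : ∀ {p : Subset n} → Nonempty p → ∃ λ x → x ∈ p × (∀ {y} → y ∈ p → x Fin.≤ y)
minimum {p = inside ∷ p} _ = zero , here , λ _ → z≤n
minimum {p = outside ∷ p} (suc y , there y∈p) with x , x∈p , x≤ ← minimum (y , y∈p) =
  suc x , there x∈p , λ { (there z∈p) → s≤s (x≤ z∈p) }

minimum-of-rest : ∀ {p : Subset n} → Nonempty p → ∃ λ x → x ∈ p × (∀ {y} → y ∈ p - x → x Fin.< y)
minimum-of-rest {p = p} ne with x , x∈p , x≤ ← minimum ne = x , x∈p , λ {y} y∈p-x →
  ≤∧≢⇒< (x≤ (p─q⊆p p ⁅ x ⁆ y∈p-x))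
        (λ x≡y → x∈p─q⇒x∉q p ⁅ x ⁆ y∈p-x (subst (_∈ ⁅ x ⁆) x≡y (x∈⁅x⁆ x)))

no-increasing-pair⇒∣p∣≤1 : ∀ {p : Subset n} →
  (∀ {x y} → x ∈ p → y ∈ p → x Fin.< y → ⊥) → ∣ p ∣ ≤ 1
no-increasing-pair⇒∣p∣≤1 {p = p} none = ℕₚ.≮⇒≥ λ 1<∣p∣ →
  let x , x∈p , x<rest = minimum-of-rest (nonempty (≤-trans (s≤s z≤n) 1<∣p∣))
      y , y∈p-x = nonempty (ℕₚ.≤-pred (≤-trans 1<∣p∣ (∣p∣≤1+∣p-x∣ p x)))
  in none x∈p (p─q⊆p p ⁅ x ⁆ y∈p-x) (x<rest y∈p-x)

no-increasing-triple⇒∣p∣≤2 : ∀ {p : Subset n} →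
  (∀ {x y z} → x ∈ p → y ∈ p → z ∈ p → x Fin.< y → y Fin.< z → ⊥) → ∣ p ∣ ≤ 2
no-increasing-triple⇒∣p∣≤2 {p = p} none = ℕₚ.≮⇒≥ λ 2<∣p∣ →
  let x , x∈p , x<rest = minimum-of-rest (nonempty (≤-trans (s≤s z≤n) 2<∣p∣))
      ⊆p = p─q⊆p p ⁅ x ⁆
      ∣p-x∣≤1 = no-increasing-pair⇒∣p∣≤1 λ y∈ z∈ y<z → none x∈p (⊆p y∈) (⊆p z∈) (x<rest y∈) y<z
  in ℕₚ.≤⇒≯ (s≤s ∣p-x∣≤1) (≤-trans 2<∣p∣ (∣p∣≤1+∣p-x∣ p x))

between : Fin n → Fin n → Subset n
between a b = tabulate (λ x → does (a Finₚ.<? x) ∧ does (x Finₚ.<? b))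

∈-between⁺ : ∀ {a b x : Fin n} → a Fin.< x → x Fin.< b → x ∈ between a b
∈-between⁺ {a = a} {b} {x} a<x x<b =
  ∈-tabulate⁺ _ (cong₂ _∧_ (dec-true (a Finₚ.<? x) a<x) (dec-true (x Finₚ.<? b) x<b))

∈-between⁻ : ∀ {a b x : Fin n} → x ∈ between a b → a Fin.< x × x Fin.< b
∈-between⁻ {a = a} {b} {x} x∈ = both (a Finₚ.<? x) (x Finₚ.<? b) (∈-tabulate⁻ _ x∈)
  where
  both : (a<x? : Dec (a Fin.< x)) (x<b? : Dec (x Fin.< b)) → does a<x? ∧ does x<b? ≡ true →
         a Fin.< x × x Fin.< b
  both (yes a<x) (yes x<b) _ = a<x , x<b

between-⊆ : ∀ {a a′ b′ b : Fin n} → a Fin.≤ a′ → b′ Fin.≤ b → between a′ b′ ⊆ between a b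
between-⊆ a≤a′ b′≤b x∈ with a′<x , x<b′ ← ∈-between⁻ x∈ =
  ∈-between⁺ (ℕₚ.≤-<-trans a≤a′ a′<x) (ℕₚ.<-≤-trans x<b′ b′≤b)

endpoint∉between : ∀ {a b p : Fin n} → p ≡ a ⊎ p ≡ b → p ∉ between a b
endpoint∉between {a = a} {b} (inj₁ refl) p∈ = Finₚ.<-irrefl refl (proj₁ (∈-between⁻ {a = a} {b} p∈))
endpoint∉between {a = a} {b} (inj₂ refl) p∈ = Finₚ.<-irrefl refl (proj₂ (∈-between⁻ {a = a} {b} p∈))

alternate : Bool → Subset n → Subset n
alternate b [] = []
alternate b (outside ∷ p) = outside ∷ alternate b p
alternate b (inside ∷ p) = b ∷ alternate (not b) p

alternate-⊆ : ∀ b (p : Subset n) → alternate b p ⊆ p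
alternate-⊆ b (outside ∷ p) (there x∈) = there (alternate-⊆ b p x∈)
alternate-⊆ true (inside ∷ p) here = here
alternate-⊆ b (inside ∷ p) (there x∈) = there (alternate-⊆ (not b) p x∈)

alternate-disjoint : ∀ b (p : Subset n) {x} → x ∈ alternate b p → x ∉ alternate (not b) p
alternate-disjoint b (outside ∷ p) (there x∈) (there x∈′) = alternate-disjoint b p x∈ x∈′
alternate-disjoint true (inside ∷ p) here ()
alternate-disjoint true (inside ∷ p) (there x∈) (there x∈′) = alternate-disjoint false p x∈ x∈′
alternate-disjoint false (inside ∷ p) (there x∈) (there x∈′) = alternate-disjoint true p x∈ x∈′

mutual
  ∣p∣≤2*∣alternate-true∣ : ∀ (p : Subset n) → ∣ p ∣ ≤ 2 * ∣ alternate true p ∣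
  ∣p∣≤2*∣alternate-true∣ [] = z≤n
  ∣p∣≤2*∣alternate-true∣ (outside ∷ p) = ∣p∣≤2*∣alternate-true∣ p
  ∣p∣≤2*∣alternate-true∣ (inside ∷ p) = begin
    suc ∣ p ∣                               ≤⟨ s≤s (∣p∣≤1+2*∣alternate-false∣ p) ⟩
    2 + 2 * ∣ alternate false p ∣            ≡⟨ ℕₚ.*-distribˡ-+ 2 1 _ ⟨
    2 * suc ∣ alternate false p ∣            ∎
    where open ℕₚ.≤-Reasoning

  ∣p∣≤1+2*∣alternate-false∣ : ∀ (p : Subset n) → ∣ p ∣ ≤ suc (2 * ∣ alternate false p ∣)
  ∣p∣≤1+2*∣alternate-false∣ [] = z≤n
  ∣p∣≤1+2*∣alternate-false∣ (outside ∷ p) = ∣p∣≤1+2*∣alternate-false∣ p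
  ∣p∣≤1+2*∣alternate-false∣ (inside ∷ p) = s≤s (∣p∣≤2*∣alternate-true∣ p)

alternate-false-after-first : ∀ (p : Subset n) {y} → y ∈ alternate false p →
  ∃ λ z → z ∈ p × z Fin.< y
alternate-false-after-first (outside ∷ p) (there y∈)
  with z , z∈p , z<y ← alternate-false-after-first p y∈ = suc z , there z∈p , s≤s z<y
alternate-false-after-first (inside ∷ p) (there y∈) = zero , here , s≤s z≤n

alternate-gap : ∀ b (p : Subset n) {x y} → x ∈ alternate b p → y ∈ alternate b p → x Fin.< y →
  ∃ λ z → z ∈ p × x Fin.< z × z Fin.< y
alternate-gap b (outside ∷ p) (there x∈) (there y∈) (s≤s x<y)
  with z , z∈p , x<z , z<y ← alternate-gap b p x∈ y∈ x<y = suc z , there z∈p , s≤s x<z , s≤s z<y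
alternate-gap true (inside ∷ p) here (there y∈) _
  with z , z∈p , z<y ← alternate-false-after-first p y∈ = suc z , there z∈p , s≤s z≤n , s≤s z<y
alternate-gap b (inside ∷ p) (there x∈) (there y∈) (s≤s x<y)
  with z , z∈p , x<z , z<y ← alternate-gap (not b) p x∈ y∈ x<y = suc z , there z∈p , s≤s x<z , s≤s z<y

-- A subset p of Fin n as the vertex set Fin ∣ p ∣

embed : ∀ (p : Subset n) → Fin ∣ p ∣ → Fin n
embed (inside ∷ p) zero = zero
embed (inside ∷ p) (suc i) = suc (embed p i)
embed (outside ∷ p) i = suc (embed p i)

embed-mono : ∀ (p : Subset n) {i j} → i Fin.< j → embed p i Fin.< embed p j
embed-mono (inside ∷ p) {zero} {suc j} _ = s≤s z≤n
embed-mono (inside ∷ p) {suc i} {suc j} (s≤s i<j) = s≤s (embed-mono p i<j)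
embed-mono (outside ∷ p) i<j = s≤s (embed-mono p i<j)

embed∈ : ∀ (p : Subset n) i → embed p i ∈ p
embed∈ (inside ∷ p) zero = here
embed∈ (inside ∷ p) (suc i) = there (embed∈ p i)
embed∈ (outside ∷ p) i = there (embed∈ p i)

embed-surjective : ∀ (p : Subset n) {x} → x ∈ p → ∃ λ i → embed p i ≡ x
embed-surjective (inside ∷ p) here = zero , refl
embed-surjective (inside ∷ p) (there x∈p) with i , refl ← embed-surjective p x∈p = suc i , refl
embed-surjective (outside ∷ p) (there x∈p) with i , refl ← embed-surjective p x∈p = i , refl

restrict : ∀ (p : Subset n) → Subset n → Subset ∣ p ∣
restrict [] [] = []
restrict (inside ∷ p) (x ∷ q) = x ∷ restrict p q
restrict (outside ∷ p) (_ ∷ q) = restrict p q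

∈-restrict⁺ : ∀ (p q : Subset n) {i} → embed p i ∈ q → i ∈ restrict p q
∈-restrict⁺ (inside ∷ p) (_ ∷ q) {zero} here = here
∈-restrict⁺ (inside ∷ p) (_ ∷ q) {suc i} (there i∈q) = there (∈-restrict⁺ p q i∈q)
∈-restrict⁺ (outside ∷ p) (_ ∷ q) (there i∈q) = ∈-restrict⁺ p q i∈q

∈-restrict⁻ : ∀ (p q : Subset n) {i} → i ∈ restrict p q → embed p i ∈ q
∈-restrict⁻ (inside ∷ p) (_ ∷ q) {zero} here = here
∈-restrict⁻ (inside ∷ p) (_ ∷ q) {suc i} (there i∈q) = there (∈-restrict⁻ p q i∈q)
∈-restrict⁻ (outside ∷ p) (_ ∷ q) i∈q = there (∈-restrict⁻ p q i∈q)

q⊆p⇒∣restrict∣≡∣q∣ : ∀ (p q : Subset n) → q ⊆ p → ∣ restrict p q ∣ ≡ ∣ q ∣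
q⊆p⇒∣restrict∣≡∣q∣ [] [] _ = refl
q⊆p⇒∣restrict∣≡∣q∣ (inside ∷ p) (inside ∷ q) q⊆p = cong suc (q⊆p⇒∣restrict∣≡∣q∣ p q (drop-∷-⊆ q⊆p))
q⊆p⇒∣restrict∣≡∣q∣ (inside ∷ p) (outside ∷ q) q⊆p = q⊆p⇒∣restrict∣≡∣q∣ p q (drop-∷-⊆ q⊆p)
q⊆p⇒∣restrict∣≡∣q∣ (outside ∷ p) (inside ∷ q) q⊆p with () ← q⊆p here
q⊆p⇒∣restrict∣≡∣q∣ (outside ∷ p) (outside ∷ q) q⊆p = q⊆p⇒∣restrict∣≡∣q∣ p q (drop-∷-⊆ q⊆p)

module _ {a} {A : Set a} where

  extend : ∀ (p : Subset n) → (Fin ∣ p ∣ → A) → A → Fin n → A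
  extend (inside ∷ p) f a zero = f zero
  extend (inside ∷ p) f a (suc x) = extend p (f ∘ suc) a x
  extend (outside ∷ p) f a zero = a
  extend (outside ∷ p) f a (suc x) = extend p f a x

  extend-embed : ∀ (p : Subset n) f a i → extend p f a (embed p i) ≡ f i
  extend-embed (inside ∷ p) f a zero = refl
  extend-embed (inside ∷ p) f a (suc i) = extend-embed p (f ∘ suc) a i
  extend-embed (outside ∷ p) f a i = extend-embed p f a i

  extend-∉ : ∀ (p : Subset n) f a {x} → x ∉ p → extend p f a x ≡ a
  extend-∉ (inside ∷ p) f a {zero} x∉p = contradiction here x∉p
  extend-∉ (inside ∷ p) f a {suc x} x∉p = extend-∉ p (f ∘ suc) a (x∉p ∘ there)
  extend-∉ (outside ∷ p) f a {zero} x∉p = refl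
  extend-∉ (outside ∷ p) f a {suc x} x∉p = extend-∉ p f a (x∉p ∘ there)

  ∣tabulate∘extend∣ : ∀ (P : A → Bool) (p : Subset n) f a →
    ∣ tabulate (P ∘ extend p f a) ∣ ≡ ∣ tabulate (P ∘ f) ∣ + (if P a then ∣ ∁ p ∣ else 0)
  ∣tabulate∘extend∣ P [] f a with P a
  ... | true = refl
  ... | false = refl
  ∣tabulate∘extend∣ P (inside ∷ p) f a with P (f zero)
  ... | true = cong suc (∣tabulate∘extend∣ P p (f ∘ suc) a)
  ... | false = ∣tabulate∘extend∣ P p (f ∘ suc) a
  ∣tabulate∘extend∣ P (outside ∷ p) f a with P a | ∣tabulate∘extend∣ P p f a
  ... | true | ih = trans (cong suc ih) (sym (+-suc _ _))
  ... | false | ih = ih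

[r+q*d]/d≡q : ∀ {r} q d .{{_ : ℕ.NonZero d}} → r < d → (r + q * d) / d ≡ q
[r+q*d]/d≡q {r} q d r<d = begin
  (r + q * d) / d     ≡⟨ +-distrib-/-∣ʳ r (n∣m*n q) ⟩
  r / d + q * d / d   ≡⟨ cong₂ _+_ (m<n⇒m/n≡0 r<d) (m*n/n≡m q d) ⟩
  q                   ∎
  where open ≡-Reasoning

data Division (k : ℕ) : ℕ → Set where
  exact   : ∀ q → Division k (q * suc k)
  inexact : ∀ q {r} → r < k → Division k (suc r + q * suc k)

division : ∀ n k → Division k n
division n k =
  subst (Division k) (sym (m≡m%n+[m/n]*n n (suc k))) (divide (n % suc k) (n / suc k) (m%n<n n (suc k)))
  where
  divide : ∀ r q → r < suc k → Division k (r + q * suc k)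
  divide zero q _ = exact q
  divide (suc r) q (s≤s r<k) = inexact q r<k

module _ (k q : ℕ) where

  ⌊exact⌋ : ⌊ q * suc k / suc k ⌋ ≡ q
  ⌊exact⌋ = m*n/n≡m q (suc k)

  ⌈exact⌉ : ⌈ q * suc k / suc k ⌉ ≡ q
  ⌈exact⌉ = trans (cong (_/ suc k) (ℕₚ.+-comm (q * suc k) k)) ([r+q*d]/d≡q q (suc k) ℕₚ.≤-refl)

  ⌊inexact⌋ : ∀ {r} → r < k → ⌊ (suc r + q * suc k) / suc k ⌋ ≡ q
  ⌊inexact⌋ r<k = [r+q*d]/d≡q q (suc k) (s≤s r<k)

  ⌈inexact⌉ : ∀ {r} → r < k → ⌈ (suc r + q * suc k) / suc k ⌉ ≡ suc q
  ⌈inexact⌉ {r} r<k =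
    trans (cong (_/ suc k) (shift r q k)) ([r+q*d]/d≡q (suc q) (suc k) (ℕₚ.m≤n⇒m≤1+n r<k))
    where
    shift : ∀ r q k → suc r + q * suc k + k ≡ r + suc q * suc k
    shift = solve-∀

⌊n/s⌋≤⌈n/s⌉ : ∀ n k → ⌊ n / suc k ⌋ ≤ ⌈ n / suc k ⌉
⌊n/s⌋≤⌈n/s⌉ n k with division n k
... | exact q rewrite ⌊exact⌋ k q | ⌈exact⌉ k q = ℕₚ.≤-refl
... | inexact q r<k rewrite ⌊inexact⌋ k q r<k | ⌈inexact⌉ k q r<k = ℕₚ.n≤1+n q

⌈n/s⌉≤1+⌊n/s⌋ : ∀ n k → ⌈ n / suc k ⌉ ≤ suc ⌊ n / suc k ⌋
⌈n/s⌉≤1+⌊n/s⌋ n k with division n k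
... | exact q rewrite ⌊exact⌋ k q | ⌈exact⌉ k q = ℕₚ.n≤1+n q
... | inexact q r<k rewrite ⌊inexact⌋ k q r<k | ⌈inexact⌉ k q r<k = ℕₚ.≤-refl

k*⌊n/s⌋+⌈n/s⌉≤n : ∀ n k → k * ⌊ n / suc k ⌋ + ⌈ n / suc k ⌉ ≤ n
k*⌊n/s⌋+⌈n/s⌉≤n n k with division n k
... | exact q rewrite ⌊exact⌋ k q | ⌈exact⌉ k q = ℕₚ.≤-reflexive (lemma k q)
  where
  lemma : ∀ k q → k * q + q ≡ q * suc k
  lemma = solve-∀
... | inexact q {r} r<k rewrite ⌊inexact⌋ k q r<k | ⌈inexact⌉ k q r<k =
  ≤-trans (ℕₚ.≤-reflexive (lemma k q)) (s≤s (ℕₚ.m≤n+m _ r))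
  where
  lemma : ∀ k q → k * q + suc q ≡ suc (q * suc k)
  lemma = solve-∀

⌈[r+q*s]/s⌉≤1+q : ∀ r q k → r < suc k → ⌈ (r + q * suc k) / suc k ⌉ ≤ suc q
⌈[r+q*s]/s⌉≤1+q zero q k _ = ≤-trans (ℕₚ.≤-reflexive (⌈exact⌉ k q)) (ℕₚ.n≤1+n q)
⌈[r+q*s]/s⌉≤1+q (suc r) q k (s≤s r<k) = ℕₚ.≤-reflexive (⌈inexact⌉ k q r<k)

private
  exact-rest : ∀ q d → q * suc (suc d) ∸ q ≡ q * suc d
  exact-rest q d = trans (cong (_∸ q) (split q d)) (ℕₚ.m+n∸n≡m (q * suc d) q)
    where
    split : ∀ q d → q * suc (suc d) ≡ q * suc d + q
    split = solve-∀

  inexact-rest : ∀ r q d → suc r + q * suc (suc d) ∸ suc q ≡ r + q * suc d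
  inexact-rest r q d = trans (cong (_∸ suc q) (split r q d)) (ℕₚ.m+n∸n≡m (r + q * suc d) (suc q))
    where
    split : ∀ r q d → suc r + q * suc (suc d) ≡ r + q * suc d + suc q
    split = solve-∀

⌊[n∸⌈n/s⌉]/[s∸1]⌋≡⌊n/s⌋ : ∀ n d → ⌊ (n ∸ ⌈ n / suc (suc d) ⌉) / suc d ⌋ ≡ ⌊ n / suc (suc d) ⌋
⌊[n∸⌈n/s⌉]/[s∸1]⌋≡⌊n/s⌋ n d with division n (suc d)
... | exact q rewrite ⌊exact⌋ (suc d) q | ⌈exact⌉ (suc d) q | exact-rest q d = ⌊exact⌋ d q
... | inexact q {r} r<k rewrite ⌊inexact⌋ (suc d) q r<k | ⌈inexact⌉ (suc d) q r<k | inexact-rest r q d =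
  [r+q*d]/d≡q q (suc d) r<k

⌈[n∸⌈n/s⌉]/[s∸1]⌉≤⌈n/s⌉ : ∀ n d → ⌈ (n ∸ ⌈ n / suc (suc d) ⌉) / suc d ⌉ ≤ ⌈ n / suc (suc d) ⌉
⌈[n∸⌈n/s⌉]/[s∸1]⌉≤⌈n/s⌉ n d with division n (suc d)
... | exact q rewrite ⌈exact⌉ (suc d) q | exact-rest q d = ℕₚ.≤-reflexive (⌈exact⌉ d q)
... | inexact q {r} r<k rewrite ⌈inexact⌉ (suc d) q r<k | inexact-rest r q d = ⌈[r+q*s]/s⌉≤1+q r q d r<k

2*m+4≤1+2*a⇒2+m≤a : ∀ m a → 2 * m + 4 ≤ suc (2 * a) → 2 + m ≤ a
2*m+4≤1+2*a⇒2+m≤a m a h = ℕₚ.≮⇒≥ λ a<2+m →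
  ℕₚ.<-irrefl refl (≤-trans (subst (_≤ suc (2 * a)) (eq m) h) (s≤s (ℕₚ.*-monoʳ-≤ 2 (ℕₚ.≤-pred a<2+m))))
  where
  eq : ∀ m → 2 * m + 4 ≡ suc (suc (2 * suc m))
  eq = solve-∀

t≤1+m∧5m+t≤3j⇒t≤j : ∀ {m t n j} → t ≤ suc m → 5 * m + t ≤ n → n ≤ 3 * j → t ≤ j
t≤1+m∧5m+t≤3j⇒t≤j {m} {t} {n} {j} t≤1+m 5m+t≤n n≤3j = ℕₚ.≮⇒≥ λ j<t → ℕₚ.<-irrefl refl (begin-strict
  5 * m          <⟨ ℕₚ.m<m+n (5 * m) (≤-trans (s≤s z≤n) j<t) ⟩
  5 * m + t      ≤⟨ 5m+t≤n ⟩
  n              ≤⟨ n≤3j ⟩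
  3 * j          ≤⟨ ℕₚ.*-monoʳ-≤ 3 (ℕₚ.≤-pred (≤-trans j<t t≤1+m)) ⟩
  3 * m          ≤⟨ ℕₚ.*-monoˡ-≤ m (ℕₚ.m≤m+n 3 2) ⟩
  5 * m          ∎)
  where open ℕₚ.≤-Reasoning

5m≤2m+5+3j⇒m≤1+j : ∀ {m j} → 5 * m ≤ 2 * m + 5 + 3 * j → m ≤ suc j
5m≤2m+5+3j⇒m≤1+j {m} {j} 5m≤ = ℕₚ.≮⇒≥ λ 1+j<m → ℕₚ.<-irrefl refl (begin-strict
  5 * m                 ≤⟨ 5m≤ ⟩
  2 * m + 5 + 3 * j     <⟨ ℕₚ.≤-reflexive (rearrange m j) ⟩
  2 * m + 3 * (2 + j)   ≤⟨ ℕₚ.+-monoʳ-≤ (2 * m) (ℕₚ.*-monoʳ-≤ 3 1+j<m) ⟩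
  2 * m + 3 * m         ≡⟨ collect m ⟩
  5 * m                 ∎)
  where
  open ℕₚ.≤-Reasoning
  rearrange : ∀ m j → suc (2 * m + 5 + 3 * j) ≡ 2 * m + 3 * (2 + j)
  rearrange = solve-∀
  collect : ∀ m → 2 * m + 3 * m ≡ 5 * m
  collect = solve-∀

5*⌊n/s⌋+⌈n/s⌉≤n : ∀ n {d} → 4 ≤ d → 5 * ⌊ n / 2 + d ⌋ + ⌈ n / 2 + d ⌉ ≤ n
5*⌊n/s⌋+⌈n/s⌉≤n n {d} 4≤d =
  ≤-trans (ℕₚ.+-monoˡ-≤ ⌈ n / 2 + d ⌉ (ℕₚ.*-monoˡ-≤ ⌊ n / 2 + d ⌋ (s≤s 4≤d))) (k*⌊n/s⌋+⌈n/s⌉≤n n (suc d))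

-- Non-crossing graphs

NonCrossing : Graph n → Set
NonCrossing {n} G = ∀ (a b c d : Fin n) → a Fin.< b → b Fin.< c → c Fin.< d →
  ¬ (adj G a c ≡ true × adj G b d ≡ true)

nonCrossing⇒outerplanar : ∀ {G : Graph n} → NonCrossing G → Outerplanar G
nonCrossing⇒outerplanar nc = id , id , nc

NonCrossingClaim : ℕ → Set
NonCrossingClaim s = ∀ (n : ℕ) (G : Graph n) → NonCrossing G →
  MinαAtLeast G ⌊ n / s ⌋ → HasEquitableColoring G s

αAtLeastIn : Graph n → Subset n → Fin n → ℕ → Set
αAtLeastIn {n} G p v k = Σ (Subset n) λ S → Independent G S × v ∈ S × S ⊆ p × k ≤ ∣ S ∣

induced : Graph n → (p : Subset n) → Graph ∣ p ∣
induced G p = record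
  { adj   = λ i j → adj G (embed p i) (embed p j)
  ; sym   = λ i j → Graph.sym G (embed p i) (embed p j)
  ; irref = λ i → irref G (embed p i)
  }

module _ (G : Graph n) (p : Subset n) where

  induced-nonCrossing : NonCrossing G → NonCrossing (induced G p)
  induced-nonCrossing nc a b c d a<b b<c c<d =
    nc _ _ _ _ (embed-mono p a<b) (embed-mono p b<c) (embed-mono p c<d)

  induced-minα : ∀ {k} → (∀ {v} → v ∈ p → αAtLeastIn G p v k) → MinαAtLeast (induced G p) k
  induced-minα {k} αIn i with S , S-indep , v∈S , S⊆p , k≤∣S∣ ← αIn (embed∈ p i) =
    restrict p S ,
    (λ u v u∈ v∈ → S-indep _ _ (∈-restrict⁻ p S u∈) (∈-restrict⁻ p S v∈)) ,
    ∈-restrict⁺ p S v∈S ,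
    subst (k ≤_) (sym (q⊆p⇒∣restrict∣≡∣q∣ p S S⊆p)) k≤∣S∣

-- Relabelling along an outerplanar placement

injective⇒surjective : ∀ {f : Fin n → Fin n} → Injective _≡_ _≡_ f → ∀ y → ∃ λ x → f x ≡ y
injective⇒surjective {suc n} {f} f-inj y with any? (λ x → f x Finₚ.≟ y)
... | yes hit = hit
... | no miss = ⊥-elim (Finₚ.<⇒notInjective (ℕₚ.n<1+n n) punchOut∘f-injective)
  where
  y≢f : ∀ x → y ≢ f x
  y≢f x y≡fx = miss (x , sym y≡fx)

  punchOut∘f-injective : Injective _≡_ _≡_ (λ x → punchOut (y≢f x))
  punchOut∘f-injective eq = f-inj (Finₚ.punchOut-injective (y≢f _) (y≢f _) eq)

∣tabulate∣≡sum : ∀ (f : Fin n → Bool) → ∣ tabulate f ∣ ≡ sum (λ i → if f i then 1 else 0)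
∣tabulate∣≡sum {zero} f = refl
∣tabulate∣≡sum {suc n} f with f zero
... | true = cong suc (∣tabulate∣≡sum (f ∘ suc))
... | false = ∣tabulate∣≡sum (f ∘ suc)

∣tabulate∘permute∣ : ∀ (σ : Permutation′ n) (f : Fin n → Bool) →
  ∣ tabulate (f ∘ (σ ⟨$⟩ʳ_)) ∣ ≡ ∣ tabulate f ∣
∣tabulate∘permute∣ σ f =
  trans (∣tabulate∣≡sum (f ∘ (σ ⟨$⟩ʳ_))) (trans (sym (sum-permute _ σ)) (sym (∣tabulate∣≡sum f)))

relabel : Graph n → (Fin n → Fin n) → Graph n
relabel G f = record
  { adj   = λ i j → adj G (f i) (f j)
  ; sym   = λ i j → Graph.sym G (f i) (f j)
  ; irref = λ i → irref G (f i)
  }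

module _ (G : Graph n) (σ : Permutation′ n) where

  relabel-minα : ∀ {k} → MinαAtLeast G k → MinαAtLeast (relabel G (σ ⟨$⟩ʳ_)) k
  relabel-minα {k} minα i with S , S-indep , σi∈S , k≤∣S∣ ← minα (σ ⟨$⟩ʳ i) =
    tabulate (lookup S ∘ (σ ⟨$⟩ʳ_)) ,
    (λ u v u∈ v∈ → S-indep _ _ (∈-lookup (∈-tabulate⁻ _ u∈)) (∈-lookup (∈-tabulate⁻ _ v∈))) ,
    ∈-tabulate⁺ _ ([]=⇒lookup σi∈S) ,
    subst (k ≤_) (sym ∣S∘σ∣≡∣S∣) k≤∣S∣
    where
    ∈-lookup : ∀ {x} → lookup S x ≡ true → x ∈ S
    ∈-lookup = lookup⇒[]= _ S
    ∣S∘σ∣≡∣S∣ : ∣ tabulate (lookup S ∘ (σ ⟨$⟩ʳ_)) ∣ ≡ ∣ S ∣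
    ∣S∘σ∣≡∣S∣ = trans (∣tabulate∘permute∣ σ (lookup S)) (cong ∣_∣ (tabulate∘lookup S))

  relabel-equitable : ∀ {s} → HasEquitableColoring (relabel G (σ ⟨$⟩ʳ_)) s → HasEquitableColoring G s
  relabel-equitable {s} (c , c-proper , c-balanced) = c ∘ (σ ⟨$⟩ˡ_) , proper , balanced
    where
    proper : Proper G (c ∘ (σ ⟨$⟩ˡ_))
    proper u v u~v =
      c-proper _ _ (subst₂ (λ x y → adj G x y ≡ true) (sym (Perm.inverseʳ σ)) (sym (Perm.inverseʳ σ)) u~v)
    balanced : ∀ i → ⌊ n / s ⌋ ≤ classSize (c ∘ (σ ⟨$⟩ˡ_)) i × classSize (c ∘ (σ ⟨$⟩ˡ_)) i ≤ ⌈ n / s ⌉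
    balanced i rewrite ∣tabulate∘permute∣ (Perm.flip σ) (λ x → does (c x Finₚ.≟ i)) = c-balanced i

nonCrossingClaim⇒claim : ∀ s → NonCrossingClaim s → Claim s
nonCrossingClaim⇒claim s claim n G (pos , pos-injective , nc) minα =
  relabel-equitable G σ (claim n (relabel G (σ ⟨$⟩ʳ_)) relabel-nonCrossing (relabel-minα G σ minα))
  where
  pos⁻¹ : Fin n → Fin n
  pos⁻¹ = proj₁ ∘ injective⇒surjective pos-injective

  pos∘pos⁻¹ : ∀ k → pos (pos⁻¹ k) ≡ k
  pos∘pos⁻¹ = proj₂ ∘ injective⇒surjective pos-injective

  σ : Permutation′ n
  σ = permutation pos⁻¹ pos (λ v → pos-injective (pos∘pos⁻¹ (pos v))) pos∘pos⁻¹

  relabel-nonCrossing : NonCrossing (relabel G pos⁻¹)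
  relabel-nonCrossing a b c d a<b b<c c<d = nc _ _ _ _ (inc a<b) (inc b<c) (inc c<d)
    where
    inc : ∀ {x y} → x Fin.< y → pos (pos⁻¹ x) Fin.< pos (pos⁻¹ y)
    inc {x} {y} = subst₂ Fin._<_ (sym (pos∘pos⁻¹ x)) (sym (pos∘pos⁻¹ y))

-- Adding a new color class

fromℕ-or-inject₁ : ∀ {k} (i : Fin (suc k)) → i ≡ Fin.fromℕ k ⊎ ∃ λ j → i ≡ Fin.inject₁ j
fromℕ-or-inject₁ {k} i with k ℕₚ.≟ Fin.toℕ i
... | yes k≡i = inj₁ (Finₚ.toℕ-injective (trans (sym k≡i) (sym (Finₚ.toℕ-fromℕ k))))
... | no k≢i = inj₂ (Fin.lower₁ i k≢i , sym (Finₚ.inject₁-lower₁ i k≢i))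

_≟ᵇ_ : Fin n → Fin n → Bool
i ≟ᵇ j = does (i Finₚ.≟ j)

fromℕ≟ᵇfromℕ : ∀ k → Fin.fromℕ k ≟ᵇ Fin.fromℕ k ≡ true
fromℕ≟ᵇfromℕ k = dec-true (Fin.fromℕ k Finₚ.≟ Fin.fromℕ k) refl

fromℕ≟ᵇinject₁ : ∀ {k} (j : Fin k) → Fin.fromℕ k ≟ᵇ Fin.inject₁ j ≡ false
fromℕ≟ᵇinject₁ {k} j = dec-false (Fin.fromℕ k Finₚ.≟ Fin.inject₁ j) Finₚ.fromℕ≢inject₁

inject₁≟ᵇfromℕ : ∀ {k} (j : Fin k) → Fin.inject₁ j ≟ᵇ Fin.fromℕ k ≡ false
inject₁≟ᵇfromℕ {k} j = dec-false (Fin.inject₁ j Finₚ.≟ Fin.fromℕ k) (Finₚ.fromℕ≢inject₁ ∘ sym)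

inject₁≟ᵇinject₁ : ∀ {k} (i j : Fin k) → Fin.inject₁ i ≟ᵇ Fin.inject₁ j ≡ i ≟ᵇ j
inject₁≟ᵇinject₁ i j =
  does-⇔ (mk⇔ Finₚ.inject₁-injective (cong Fin.inject₁)) (Fin.inject₁ i Finₚ.≟ Fin.inject₁ j) (i Finₚ.≟ j)

module _ (G : Graph n) (I : Subset n) (I-indep : Independent G I) {k} (c : Fin ∣ ∁ I ∣ → Fin k) where

  withFreshColor : Fin n → Fin (suc k)
  withFreshColor = extend (∁ I) (Fin.inject₁ ∘ c) (Fin.fromℕ k)

  withFreshColor-proper : Proper (induced G (∁ I)) c → Proper G withFreshColor
  withFreshColor-proper c-proper u v u~v same with u ∈? ∁ I | v ∈? ∁ I
  ... | yes u∈ | yes v∈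
    with i , refl ← embed-surjective (∁ I) u∈ | j , refl ← embed-surjective (∁ I) v∈ =
    c-proper i j u~v (Finₚ.inject₁-injective (begin
      Fin.inject₁ (c i)   ≡⟨ extend-embed (∁ I) _ _ i ⟨
      withFreshColor _    ≡⟨ same ⟩
      withFreshColor _    ≡⟨ extend-embed (∁ I) _ _ j ⟩
      Fin.inject₁ (c j)   ∎))
    where open ≡-Reasoning
  ... | yes u∈ | no v∉ with i , refl ← embed-surjective (∁ I) u∈ =
    Finₚ.fromℕ≢inject₁ (trans (sym (extend-∉ (∁ I) _ _ v∉)) (trans (sym same) (extend-embed (∁ I) _ _ i)))
  ... | no u∉ | yes v∈ with j , refl ← embed-surjective (∁ I) v∈ =
    Finₚ.fromℕ≢inject₁ (trans (sym (extend-∉ (∁ I) _ _ u∉)) (trans same (extend-embed (∁ I) _ _ j)))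
  ... | no u∉ | no v∉ with () ← trans (sym u~v) (I-indep u v (x∉∁p⇒x∈p u∉) (x∉∁p⇒x∈p v∉))

  classSize-fresh : classSize withFreshColor (Fin.fromℕ k) ≡ ∣ I ∣
  classSize-fresh = begin
    classSize withFreshColor (Fin.fromℕ k)
      ≡⟨ ∣tabulate∘extend∣ (_≟ᵇ Fin.fromℕ k) (∁ I) _ _ ⟩
    ∣ tabulate (λ u → Fin.inject₁ (c u) ≟ᵇ Fin.fromℕ k) ∣
      + (if Fin.fromℕ k ≟ᵇ Fin.fromℕ k then ∣ ∁ (∁ I) ∣ else 0)
      ≡⟨ cong₂ _+_ (Empty⇒∣p∣≡0 no-old-vertex)
                   (cong (λ b → if b then ∣ ∁ (∁ I) ∣ else 0) (fromℕ≟ᵇfromℕ k)) ⟩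
    ∣ ∁ (∁ I) ∣
      ≡⟨ cong ∣_∣ (∁-involutive I) ⟩
    ∣ I ∣ ∎
    where
    open ≡-Reasoning
    no-old-vertex : Empty (tabulate (λ u → Fin.inject₁ (c u) ≟ᵇ Fin.fromℕ k))
    no-old-vertex (u , u∈) = contradiction (trans (sym (∈-tabulate⁻ _ u∈)) (inject₁≟ᵇfromℕ (c u))) λ ()

  classSize-inject₁ : ∀ j → classSize withFreshColor (Fin.inject₁ j) ≡ classSize c j
  classSize-inject₁ j = begin
    classSize withFreshColor (Fin.inject₁ j)
      ≡⟨ ∣tabulate∘extend∣ (_≟ᵇ Fin.inject₁ j) (∁ I) _ _ ⟩
    ∣ tabulate (λ u → Fin.inject₁ (c u) ≟ᵇ Fin.inject₁ j) ∣
      + (if Fin.fromℕ k ≟ᵇ Fin.inject₁ j then ∣ ∁ (∁ I) ∣ else 0)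
      ≡⟨ cong₂ _+_ (cong ∣_∣ (tabulate-cong λ u → inject₁≟ᵇinject₁ (c u) j))
                   (cong (λ b → if b then ∣ ∁ (∁ I) ∣ else 0) (fromℕ≟ᵇinject₁ j)) ⟩
    classSize c j + 0
      ≡⟨ ℕₚ.+-identityʳ _ ⟩
    classSize c j ∎
    where open ≡-Reasoning

freshClass-equitable : ∀ {k} (G : Graph n) (I : Subset n) → Independent G I →
  HasEquitableColoring (induced G (∁ I)) k →
  ⌊ n / suc k ⌋ ≤ ⌊ ∣ ∁ I ∣ / k ⌋ → ⌈ ∣ ∁ I ∣ / k ⌉ ≤ ⌈ n / suc k ⌉ →
  ⌊ n / suc k ⌋ ≤ ∣ I ∣ → ∣ I ∣ ≤ ⌈ n / suc k ⌉ →
  HasEquitableColoring G (suc k)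
freshClass-equitable {n} {k} G I I-indep (c , c-proper , c-balanced) ⌊⌋≤⌊⌋ ⌈⌉≤⌈⌉ ⌊⌋≤∣I∣ ∣I∣≤⌈⌉ =
  withFreshColor G I I-indep c , withFreshColor-proper G I I-indep c c-proper , balanced
  where
  balanced : ∀ i → ⌊ n / suc k ⌋ ≤ classSize (withFreshColor G I I-indep c) i
                 × classSize (withFreshColor G I I-indep c) i ≤ ⌈ n / suc k ⌉
  balanced i with fromℕ-or-inject₁ i
  ... | inj₁ refl rewrite classSize-fresh G I I-indep c = ⌊⌋≤∣I∣ , ∣I∣≤⌈⌉
  ... | inj₂ (j , refl) rewrite classSize-inject₁ G I I-indep c j =
    ≤-trans ⌊⌋≤⌊⌋ (proj₁ (c-balanced j)) , ≤-trans (proj₂ (c-balanced j)) ⌈⌉≤⌈⌉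

-- Finding the new color class

Removable : Graph n → ℕ → Subset n → Set
Removable G m I = Independent G I × (∀ {w} → w ∈ ∁ I → αAtLeastIn G (∁ I) w m)

module NonCrossingGraph {n} (G : Graph n) (nc : NonCrossing G) where

  infix 4 _~_
  _~_ : Fin n → Fin n → Set
  u ~ v = adj G u v ≡ true

  ~-sym : ∀ {u v} → u ~ v → v ~ u
  ~-sym {u} {v} u~v = trans (Graph.sym G v u) u~v

  ~⇒≢ : ∀ {u v} → u ~ v → u ≢ v
  ~⇒≢ {u} u~u refl with () ← trans (sym u~u) (irref G u)

  ≁⇒adj≡false : ∀ {u v} → ¬ u ~ v → adj G u v ≡ false
  ≁⇒adj≡false = ¬-not

  uncrossed : ∀ {a b c d} → a Fin.< b → b Fin.< c → c Fin.< d → a ~ c → b ~ d → ⊥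
  uncrossed a<b b<c c<d a~c b~d = nc _ _ _ _ a<b b<c c<d (a~c , b~d)

  N : Fin n → Subset n
  N v = tabulate (adj G v)

  N[_] : Fin n → Subset n
  N[ v ] = ⁅ v ⁆ ∪ N v

  ∈N⁺ : ∀ {u v} → u ~ v → v ∈ N u
  ∈N⁺ = ∈-tabulate⁺ _

  ∈N⁻ : ∀ {u v} → v ∈ N u → u ~ v
  ∈N⁻ = ∈-tabulate⁻ _

  ∣N∩N∣≤2-ordered : ∀ {x y} → x Fin.< y → ∣ N x ∩ N y ∣ ≤ 2
  ∣N∩N∣≤2-ordered {x} {y} x<y = no-increasing-triple⇒∣p∣≤2 no-triple
    where
    Between Beyond : Fin n → Set
    Between z = x Fin.< z × z Fin.< y
    Beyond z = z Fin.< x ⊎ y Fin.< z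

    Common : Fin n → Set
    Common z = x ~ z × y ~ z

    common : ∀ {z} → z ∈ N x ∩ N y → Common z
    common z∈ with z∈Nx , z∈Ny ← x∈p∩q⁻ (N x) (N y) z∈ = ∈N⁻ z∈Nx , ∈N⁻ z∈Ny

    side : ∀ {z} → Common z → Between z ⊎ Beyond z
    side {z} (x~z , y~z) with <-cmp z x | <-cmp z y
    ... | tri< z<x _ _ | _ = inj₂ (inj₁ z<x)
    ... | tri≈ _ z≡x _ | _ = contradiction (sym z≡x) (~⇒≢ x~z)
    ... | tri> _ _ x<z | tri< z<y _ _ = inj₁ (x<z , z<y)
    ... | tri> _ _ _ | tri≈ _ z≡y _ = contradiction (sym z≡y) (~⇒≢ y~z)
    ... | tri> _ _ _ | tri> _ _ y<z = inj₂ (inj₂ y<z)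

    between-pair : ∀ {z z′} → z Fin.< z′ → Common z → Common z′ → Between z → Between z′ → ⊥
    between-pair z<z′ (_ , y~z) (x~z′ , _) (x<z , _) (_ , z′<y) = uncrossed x<z z<z′ z′<y x~z′ (~-sym y~z)

    beyond-pair : ∀ {z z′} → z Fin.< z′ → Common z → Common z′ → Beyond z → Beyond z′ → ⊥
    beyond-pair z<z′ (x~z , y~z) (x~z′ , y~z′) (inj₁ z<x) (inj₁ z′<x) =
      uncrossed z<z′ z′<x x<y (~-sym x~z) (~-sym y~z′)
    beyond-pair z<z′ (x~z , y~z) (x~z′ , y~z′) (inj₁ z<x) (inj₂ y<z′) =
      uncrossed z<x x<y y<z′ (~-sym y~z) x~z′
    beyond-pair z<z′ (x~z , y~z) (x~z′ , y~z′) (inj₂ y<z) (inj₁ z′<x) =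
      Finₚ.<-asym x<y (Finₚ.<-trans (Finₚ.<-trans y<z z<z′) z′<x)
    beyond-pair z<z′ (x~z , y~z) (x~z′ , y~z′) (inj₂ y<z) (inj₂ y<z′) =
      uncrossed x<y y<z z<z′ x~z y~z′

    no-triple : ∀ {z₁ z₂ z₃} → z₁ ∈ N x ∩ N y → z₂ ∈ N x ∩ N y → z₃ ∈ N x ∩ N y →
                z₁ Fin.< z₂ → z₂ Fin.< z₃ → ⊥
    no-triple z₁∈ z₂∈ z₃∈ z₁<z₂ z₂<z₃ with side (common z₁∈) | side (common z₂∈) | side (common z₃∈)
    ... | inj₁ b₁ | inj₁ b₂ | _ = between-pair z₁<z₂ (common z₁∈) (common z₂∈) b₁ b₂
    ... | inj₂ o₁ | inj₂ o₂ | _ = beyond-pair z₁<z₂ (common z₁∈) (common z₂∈) o₁ o₂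
    ... | _ | inj₁ b₂ | inj₁ b₃ = between-pair z₂<z₃ (common z₂∈) (common z₃∈) b₂ b₃
    ... | _ | inj₂ o₂ | inj₂ o₃ = beyond-pair z₂<z₃ (common z₂∈) (common z₃∈) o₂ o₃
    ... | inj₁ b₁ | inj₂ _ | inj₁ b₃ =
      between-pair (Finₚ.<-trans z₁<z₂ z₂<z₃) (common z₁∈) (common z₃∈) b₁ b₃
    ... | inj₂ o₁ | inj₁ _ | inj₂ o₃ =
      beyond-pair (Finₚ.<-trans z₁<z₂ z₂<z₃) (common z₁∈) (common z₃∈) o₁ o₃

  ∣N∩N∣≤2 : ∀ {x y} → x ≢ y → ∣ N x ∩ N y ∣ ≤ 2
  ∣N∩N∣≤2 {x} {y} x≢y with <-cmp x y
  ... | tri< x<y _ _ = ∣N∩N∣≤2-ordered x<y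
  ... | tri≈ _ x≡y _ = contradiction x≡y x≢y
  ... | tri> _ _ y<x = subst (_≤ 2) (cong ∣_∣ (∩-comm (N y) (N x))) (∣N∩N∣≤2-ordered y<x)

  Chord : Subset n → Fin n → Fin n → Set
  Chord U a b = a Fin.< b × a ~ b × Nonempty (U ∩ between a b)

  LowDegreeVertex : Subset n → Set
  LowDegreeVertex U = ∃ λ r → r ∈ U × ∣ U ∩ N r ∣ ≤ 2

  -- If no edge at p has a vertex of U strictly under it, then p has no three neighbours in U:
  -- the middle one would lie under the edge to an outer one.
  lowDegree-or-chord : ∀ U {p} → p ∈ U →
    ∣ U ∩ N p ∣ ≤ 2 ⊎ ∃₂ λ a b → Chord U a b × (p ≡ a ⊎ p ≡ b)
  lowDegree-or-chord U {p} p∈U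
    with any? (λ q → q ∈? U ∩ N p ×-dec (nonempty? (U ∩ between q p) ⊎-dec nonempty? (U ∩ between p q)))
  ... | yes (q , q∈ , inj₁ (x , x∈)) =
    let q<x , x<p = ∈-between⁻ (proj₂ (x∈p∩q⁻ U _ x∈)) in
    inj₂ (q , p , (Finₚ.<-trans q<x x<p , ~-sym (∈N⁻ (proj₂ (x∈p∩q⁻ U _ q∈))) , x , x∈) , inj₂ refl)
  ... | yes (q , q∈ , inj₂ (x , x∈)) =
    let p<x , x<q = ∈-between⁻ (proj₂ (x∈p∩q⁻ U _ x∈)) in
    inj₂ (p , q , (Finₚ.<-trans p<x x<q , ∈N⁻ (proj₂ (x∈p∩q⁻ U _ q∈)) , x , x∈) , inj₁ refl)
  ... | no no-chord = inj₁ (no-increasing-triple⇒∣p∣≤2 no-triple)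
    where
    no-triple : ∀ {x y z} → x ∈ U ∩ N p → y ∈ U ∩ N p → z ∈ U ∩ N p → x Fin.< y → y Fin.< z → ⊥
    no-triple {x} {y} {z} x∈ y∈ z∈ x<y y<z with y∈U , y∈Np ← x∈p∩q⁻ U (N p) y∈ | <-cmp y p
    ... | tri< y<p _ _ = no-chord (x , x∈ , inj₁ (y , x∈p∩q⁺ (y∈U , ∈-between⁺ x<y y<p)))
    ... | tri≈ _ y≡p _ = ~⇒≢ (∈N⁻ y∈Np) (sym y≡p)
    ... | tri> _ _ p<y = no-chord (z , z∈ , inj₂ (y , x∈p∩q⁺ (y∈U , ∈-between⁺ p<y y<z)))

  nested-chord : ∀ {a b p a′ b′} → a ~ b → a Fin.< p → p Fin.< b → a′ ~ b′ → a′ Fin.< b′ →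
    p ≡ a′ ⊎ p ≡ b′ → a Fin.≤ a′ × b′ Fin.≤ b
  nested-chord a~b a<p p<b a′~b′ a′<b′ (inj₁ refl) =
    ℕₚ.<⇒≤ a<p , ℕₚ.≮⇒≥ λ b<b′ → uncrossed a<p p<b b<b′ a~b a′~b′
  nested-chord a~b a<p p<b a′~b′ a′<b′ (inj₂ refl) =
    ℕₚ.≮⇒≥ (λ a′<a → uncrossed a′<a a<p p<b a′~b′ a~b) , ℕₚ.<⇒≤ p<b

  -- The chord found at p is nested in (a, b) and has p as an endpoint, so fewer vertices of U
  -- lie under it.
  lowDegree-under-chord : ∀ U {a b} → Chord U a b → Acc _<_ ∣ U ∩ between a b ∣ → LowDegreeVertex U
  lowDegree-under-chord U {a} {b} (a<b , a~b , p , p∈) (acc smaller)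
    with p∈U , p∈ab ← x∈p∩q⁻ U _ p∈ | lowDegree-or-chord U p∈U
  ... | inj₁ low = p , p∈U , low
  ... | inj₂ (a′ , b′ , chord@(a′<b′ , a′~b′ , _) , p-endpoint) =
    lowDegree-under-chord U chord (smaller (p⊂q⇒∣p∣<∣q∣ (inner⊆outer , p , p∈ , p∉inner)))
    where
    a<p×p<b = ∈-between⁻ p∈ab
    bounds = nested-chord a~b (proj₁ a<p×p<b) (proj₂ a<p×p<b) a′~b′ a′<b′ p-endpoint
    inner⊆outer : U ∩ between a′ b′ ⊆ U ∩ between a b
    inner⊆outer x∈ with x∈U , x∈a′b′ ← x∈p∩q⁻ U _ x∈ =
      x∈p∩q⁺ (x∈U , between-⊆ (proj₁ bounds) (proj₂ bounds) x∈a′b′)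
    p∉inner : p ∉ U ∩ between a′ b′
    p∉inner p∈′ = endpoint∉between p-endpoint (proj₂ (x∈p∩q⁻ U _ p∈′))

  lowDegreeVertex : ∀ U → Nonempty U → LowDegreeVertex U
  lowDegreeVertex U (p , p∈U) with lowDegree-or-chord U p∈U
  ... | inj₁ low = p , p∈U , low
  ... | inj₂ (_ , _ , chord , _) = lowDegree-under-chord U chord (<-wellFounded _)

  independent⇒≁ : ∀ {S u v} → Independent G S → u ∈ S → v ∈ S → ¬ u ~ v
  independent⇒≁ S-indep u∈ v∈ u~v with () ← trans (sym u~v) (S-indep _ _ u∈ v∈)

  ∉N[]⇒≁ : ∀ {w v} → v ∉ N[ w ] → adj G w v ≡ false
  ∉N[]⇒≁ v∉ = ≁⇒adj≡false (λ w~v → v∉ (q⊆p∪q ⁅ _ ⁆ _ (∈N⁺ w~v)))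

  ⁅⁆∪-independent : ∀ {w J} → Independent G J → (∀ {v} → v ∈ J → v ∉ N[ w ]) →
    Independent G (⁅ w ⁆ ∪ J)
  ⁅⁆∪-independent {w} {J} J-indep J-avoids u v u∈ v∈ with x∈p∪q⁻ ⁅ w ⁆ J u∈ | x∈p∪q⁻ ⁅ w ⁆ J v∈
  ... | inj₁ u∈⁅w⁆ | inj₁ v∈⁅w⁆
    rewrite x∈⁅y⁆⇒x≡y w u∈⁅w⁆ | x∈⁅y⁆⇒x≡y w v∈⁅w⁆ = irref G w
  ... | inj₁ u∈⁅w⁆ | inj₂ v∈J rewrite x∈⁅y⁆⇒x≡y w u∈⁅w⁆ = ∉N[]⇒≁ (J-avoids v∈J)
  ... | inj₂ u∈J | inj₁ v∈⁅w⁆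
    rewrite x∈⁅y⁆⇒x≡y w v∈⁅w⁆ = trans (Graph.sym G u w) (∉N[]⇒≁ (J-avoids u∈J))
  ... | inj₂ u∈J | inj₂ v∈J = J-indep u v u∈J v∈J

  ∣U∩N[r]∣≤1+∣U∩Nr∣ : ∀ U r → ∣ U ∩ N[ r ] ∣ ≤ suc ∣ U ∩ N r ∣
  ∣U∩N[r]∣≤1+∣U∩Nr∣ U r = begin
    ∣ U ∩ N[ r ] ∣                       ≡⟨ cong ∣_∣ (∩-distribˡ-∪ U ⁅ r ⁆ (N r)) ⟩
    ∣ U ∩ ⁅ r ⁆ ∪ U ∩ N r ∣               ≤⟨ ∣p∪q∣≤∣p∣+∣q∣ (U ∩ ⁅ r ⁆) (U ∩ N r) ⟩
    ∣ U ∩ ⁅ r ⁆ ∣ + ∣ U ∩ N r ∣           ≤⟨ ℕₚ.+-monoˡ-≤ ∣ U ∩ N r ∣ (∣p∩⁅x⁆∣≤1 U r) ⟩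
    suc ∣ U ∩ N r ∣                       ∎
    where open ℕₚ.≤-Reasoning

  x∈N[x] : ∀ x → x ∈ N[ x ]
  x∈N[x] x = p⊆p∪q (N x) (x∈⁅x⁆ x)

  adjoin : ∀ {p w J} → w ∈ p → J ⊆ p ─ N[ w ] → Independent G J →
    ⁅ w ⁆ ∪ J ⊆ p × Independent G (⁅ w ⁆ ∪ J) × ∣ ⁅ w ⁆ ∪ J ∣ ≡ suc ∣ J ∣
  adjoin {p} {w} {J} w∈p J⊆ J-indep =
    (λ v∈ → [ (λ v∈⁅w⁆ → subst (_∈ p) (sym (x∈⁅y⁆⇒x≡y w v∈⁅w⁆)) w∈p) , (λ v∈J → p─q⊆p p _ (J⊆ v∈J)) ]
              (x∈p∪q⁻ ⁅ w ⁆ J v∈)) ,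
    ⁅⁆∪-independent J-indep avoids ,
    x∉p⇒∣⁅x⁆∪p∣≡1+∣p∣ (λ w∈J → avoids w∈J (x∈N[x] w))
    where
    avoids : ∀ {v} → v ∈ J → v ∉ N[ w ]
    avoids v∈J = x∈p─q⇒x∉q p N[ w ] (J⊆ v∈J)

  αAtLeastIn-adjoin : ∀ {p w J k} → w ∈ p → J ⊆ p ─ N[ w ] → Independent G J → k ≤ suc ∣ J ∣ →
    αAtLeastIn G p w k
  αAtLeastIn-adjoin {w = w} {J} {k} w∈p J⊆ J-indep k≤
    with ⊆p , indep , ∣⁅w⁆∪J∣≡ ← adjoin w∈p J⊆ J-indep =
    ⁅ w ⁆ ∪ J , indep , p⊆p∪q J (x∈⁅x⁆ w) , ⊆p , subst (k ≤_) (sym ∣⁅w⁆∪J∣≡) k≤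

  independent-third : ∀ U → ∃ λ J → J ⊆ U × Independent G J × ∣ U ∣ ≤ 3 * ∣ J ∣
  independent-third U = go U (<-wellFounded _)
    where
    go : ∀ U → Acc _<_ ∣ U ∣ → ∃ λ J → J ⊆ U × Independent G J × ∣ U ∣ ≤ 3 * ∣ J ∣
    go U (acc smaller) with nonempty? U
    ... | no empty =
      Subset.⊥ , ⊥⊆ , (λ _ _ u∈⊥ → contradiction u∈⊥ ∉⊥) ,
      ≤-trans (ℕₚ.≤-reflexive (Empty⇒∣p∣≡0 empty)) z≤n
    ... | yes ne with r , r∈U , deg≤2 ← lowDegreeVertex U ne
      with J , J⊆ , J-indep , ∣U─N[r]∣≤3∣J∣
             ← go (U ─ N[ r ]) (smaller (p∩q≢∅⇒∣p─q∣<∣p∣ U N[ r ] (r , x∈p∩q⁺ (r∈U , x∈N[x] r))))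
      with ⊆U , indep , ∣⁅r⁆∪J∣≡ ← adjoin r∈U J⊆ J-indep
      = ⁅ r ⁆ ∪ J , ⊆U , indep , (begin
        ∣ U ∣                               ≡⟨ ∣p∣≡∣p∩q∣+∣p─q∣ U N[ r ] ⟩
        ∣ U ∩ N[ r ] ∣ + ∣ U ─ N[ r ] ∣     ≤⟨ ℕₚ.+-mono-≤ (≤-trans (∣U∩N[r]∣≤1+∣U∩Nr∣ U r) (s≤s deg≤2))
                                                          ∣U─N[r]∣≤3∣J∣ ⟩
        3 + 3 * ∣ J ∣                       ≡⟨ ℕₚ.*-suc 3 ∣ J ∣ ⟨
        3 * suc ∣ J ∣                       ≡⟨ cong (3 *_) ∣⁅r⁆∪J∣≡ ⟨
        3 * ∣ ⁅ r ⁆ ∪ J ∣                   ∎)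
      where open ℕₚ.≤-Reasoning

  -- The fan of w starts after its least neighbour x₀; if w lies between u and v, the chord w x₀
  -- crosses u v.
  fan-gap : ∀ {w x₀ u z v} → w ~ x₀ → x₀ Fin.< u → u Fin.< z → z Fin.< v →
    w ~ u → w ~ z → w ~ v → ¬ u ~ v
  fan-gap {w} {u = u} {v = v} w~x₀ x₀<u u<z z<v w~u w~z w~v u~v with <-cmp w u | <-cmp v w
  ... | tri< w<u _ _ | _ = uncrossed w<u u<z z<v w~z u~v
  ... | tri≈ _ w≡u _ | _ = ~⇒≢ w~u w≡u
  ... | tri> _ _ u<w | tri< v<w _ _ = uncrossed u<z z<v v<w u~v (~-sym w~z)
  ... | tri> _ _ u<w | tri≈ _ v≡w _ = ~⇒≢ w~v (sym v≡w)
  ... | tri> _ _ u<w | tri> _ _ w<v = uncrossed x₀<u u<w w<v (~-sym w~x₀) u~v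

  module Fan {w x₀} (x₀∈N : x₀ ∈ N w) (x₀<fan : ∀ {y} → y ∈ N w - x₀ → x₀ Fin.< y) where

    fan : Subset n
    fan = N w - x₀

    fan⊆N : fan ⊆ N w
    fan⊆N = p─q⊆p (N w) ⁅ x₀ ⁆

    alternate-≁ : ∀ b {u v} → u Fin.< v → u ∈ alternate b fan → v ∈ alternate b fan → adj G u v ≡ false
    alternate-≁ b u<v u∈ v∈ with z , z∈ , u<z , z<v ← alternate-gap b fan u∈ v∈ u<v =
      ≁⇒adj≡false (fan-gap (∈N⁻ x₀∈N) (x₀<fan u∈fan) u<z z<v
                           (∈N⁻ (fan⊆N u∈fan)) (∈N⁻ (fan⊆N z∈)) (∈N⁻ (fan⊆N v∈fan)))
      where
      u∈fan = alternate-⊆ b fan u∈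
      v∈fan = alternate-⊆ b fan v∈

    alternate-independent : ∀ b → Independent G (alternate b fan)
    alternate-independent b u v u∈ v∈ with <-cmp u v
    ... | tri< u<v _ _ = alternate-≁ b u<v u∈ v∈
    ... | tri≈ _ refl _ = irref G u
    ... | tri> _ _ v<u = trans (Graph.sym G u v) (alternate-≁ b v<u v∈ u∈)

  module HighDegree {m w₀ x₀} (minα : MinαAtLeast G m) (x₀∈N : x₀ ∈ N w₀)
                    (x₀<fan : ∀ {y} → y ∈ N w₀ - x₀ → x₀ Fin.< y)
                    (2m+4≤∣fan∣ : 2 * m + 4 ≤ ∣ N w₀ - x₀ ∣) where

    open Fan x₀∈N x₀<fan

    A B : Subset n
    A = alternate true fan
    B = alternate false fan

    2+m≤∣A∣ : 2 + m ≤ ∣ A ∣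
    2+m≤∣A∣ = 2*m+4≤1+2*a⇒2+m≤a m ∣ A ∣
      (≤-trans 2m+4≤∣fan∣ (≤-trans (∣p∣≤2*∣alternate-true∣ fan) (ℕₚ.n≤1+n _)))

    2+m≤∣B∣ : 2 + m ≤ ∣ B ∣
    2+m≤∣B∣ = 2*m+4≤1+2*a⇒2+m≤a m ∣ B ∣ (≤-trans 2m+4≤∣fan∣ (∣p∣≤1+2*∣alternate-false∣ fan))

    module _ {I} (I⊆A : I ⊆ A) where

      I-independent : Independent G I
      I-independent u v u∈ v∈ = alternate-independent true u v (I⊆A u∈) (I⊆A v∈)

      I⊆N : I ⊆ N w₀
      I⊆N = fan⊆N ∘ alternate-⊆ true fan ∘ I⊆A

      w₀-keeps-α : αAtLeastIn G (∁ I) w₀ m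
      w₀-keeps-α with S , S-indep , w₀∈S , m≤∣S∣ ← minα w₀ =
        S , S-indep , w₀∈S ,
        (λ v∈S → x∉p⇒x∈∁p λ v∈I → independent⇒≁ S-indep w₀∈S v∈S (∈N⁻ (I⊆N v∈I))) ,
        m≤∣S∣

      other-keeps-α : ∀ {w} → w ∈ ∁ I → w ≢ w₀ → αAtLeastIn G (∁ I) w m
      other-keeps-α {w} w∈ w≢w₀ = αAtLeastIn-adjoin w∈ J⊆ J-indep m≤1+∣J∣
        where
        J : Subset n
        J = B ─ N[ w ]

        J⊆B : J ⊆ B
        J⊆B = p─q⊆p B N[ w ]

        J⊆ : J ⊆ ∁ I ─ N[ w ]
        J⊆ v∈J = x∈p∧x∉q⇒x∈p─q (x∉p⇒x∈∁p λ v∈I → alternate-disjoint true fan (I⊆A v∈I) (J⊆B v∈J))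
                               (x∈p─q⇒x∉q B N[ w ] v∈J)

        J-indep : Independent G J
        J-indep u v u∈ v∈ = alternate-independent false u v (J⊆B u∈) (J⊆B v∈)

        B∩Nw⊆N∩N : B ∩ N w ⊆ N w₀ ∩ N w
        B∩Nw⊆N∩N v∈ with v∈B , v∈Nw ← x∈p∩q⁻ B (N w) v∈ =
          x∈p∩q⁺ (fan⊆N (alternate-⊆ false fan v∈B) , v∈Nw)

        ∣B∩N[w]∣≤3 : ∣ B ∩ N[ w ] ∣ ≤ 3
        ∣B∩N[w]∣≤3 = ≤-trans (∣U∩N[r]∣≤1+∣U∩Nr∣ B w)
                             (s≤s (≤-trans (p⊆q⇒∣p∣≤∣q∣ B∩Nw⊆N∩N) (∣N∩N∣≤2 (w≢w₀ ∘ sym))))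

        m≤1+∣J∣ : m ≤ suc ∣ J ∣
        m≤1+∣J∣ = ℕₚ.≤-pred (ℕₚ.≤-pred (begin
          2 + m                  ≤⟨ 2+m≤∣B∣ ⟩
          ∣ B ∣                  ≡⟨ ∣p∣≡∣p∩q∣+∣p─q∣ B N[ w ] ⟩
          ∣ B ∩ N[ w ] ∣ + ∣ J ∣  ≤⟨ ℕₚ.+-monoˡ-≤ ∣ J ∣ ∣B∩N[w]∣≤3 ⟩
          3 + ∣ J ∣              ∎))
          where open ℕₚ.≤-Reasoning

      keeps-α : ∀ {w} → w ∈ ∁ I → αAtLeastIn G (∁ I) w m
      keeps-α {w} w∈ with w Finₚ.≟ w₀
      ... | yes refl = w₀-keeps-α
      ... | no w≢w₀ = other-keeps-α w∈ w≢w₀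

    removable : ∀ {t} → t ≤ suc m → ∃ λ I → ∣ I ∣ ≡ t × Removable G m I
    removable {t} t≤1+m with I , I⊆A , ∣I∣≡t ← shrink A t (≤-trans t≤1+m (≤-trans (ℕₚ.n≤1+n _) 2+m≤∣A∣)) =
      I , ∣I∣≡t , I-independent I⊆A , keeps-α I⊆A

  highDegree-removable : ∀ {m t w₀} → MinαAtLeast G m → 2 * m + 4 < ∣ N w₀ ∣ → t ≤ suc m →
    ∃ λ I → ∣ I ∣ ≡ t × Removable G m I
  highDegree-removable {m} {w₀ = w₀} minα 2m+4<deg
    with x₀ , x₀∈N , x₀<fan ← minimum-of-rest (nonempty (≤-trans (s≤s z≤n) 2m+4<deg)) =
    HighDegree.removable minα x₀∈N x₀<fan (ℕₚ.≤-pred (≤-trans 2m+4<deg (∣p∣≤1+∣p-x∣ (N w₀) x₀)))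

  lowDegree-removable : ∀ {m t} → (∀ w → ∣ N w ∣ ≤ 2 * m + 4) → t ≤ suc m → 5 * m + t ≤ n →
    ∃ λ I → ∣ I ∣ ≡ t × Removable G m I
  lowDegree-removable {m} {t} maxdeg t≤1+m 5m+t≤n
    with J₀ , _ , J₀-indep , n≤3∣J₀∣ ← independent-third Subset.⊤
    with I , I⊆J₀ , ∣I∣≡t
           ← shrink J₀ t (t≤1+m∧5m+t≤3j⇒t≤j t≤1+m 5m+t≤n (subst (_≤ 3 * ∣ J₀ ∣) (∣⊤∣≡n n) n≤3∣J₀∣)) =
    I , ∣I∣≡t , (λ u v u∈ v∈ → J₀-indep u v (I⊆J₀ u∈) (I⊆J₀ v∈)) , keeps-α
    where
    5m≤∣∁I∣ : 5 * m ≤ ∣ ∁ I ∣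
    5m≤∣∁I∣ = subst (5 * m ≤_) (sym (trans (∣∁p∣≡n∸∣p∣ I) (cong (n ∸_) ∣I∣≡t)))
                    (ℕₚ.m+n≤o⇒m≤o∸n (5 * m) 5m+t≤n)

    keeps-α : ∀ {w} → w ∈ ∁ I → αAtLeastIn G (∁ I) w m
    keeps-α {w} w∈ with J , J⊆ , J-indep , ∣rest∣≤3∣J∣ ← independent-third (∁ I ─ N[ w ]) =
      αAtLeastIn-adjoin w∈ J⊆ J-indep (5m≤2m+5+3j⇒m≤1+j (begin
        5 * m                                ≤⟨ 5m≤∣∁I∣ ⟩
        ∣ ∁ I ∣                              ≡⟨ ∣p∣≡∣p∩q∣+∣p─q∣ (∁ I) N[ w ] ⟩
        ∣ ∁ I ∩ N[ w ] ∣ + ∣ ∁ I ─ N[ w ] ∣  ≤⟨ ℕₚ.+-mono-≤ ∣∁I∩N[w]∣≤ ∣rest∣≤3∣J∣ ⟩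
        suc (2 * m + 4) + 3 * ∣ J ∣          ≡⟨ cong (_+ 3 * ∣ J ∣) (+-suc (2 * m) 4) ⟨
        2 * m + 5 + 3 * ∣ J ∣                ∎))
      where
      open ℕₚ.≤-Reasoning
      ∣∁I∩N[w]∣≤ : ∣ ∁ I ∩ N[ w ] ∣ ≤ suc (2 * m + 4)
      ∣∁I∩N[w]∣≤ = ≤-trans (∣U∩N[r]∣≤1+∣U∩Nr∣ (∁ I) w) (s≤s (≤-trans (∣p∩q∣≤∣q∣ (∁ I) (N w)) (maxdeg w)))

  removable : ∀ {m t} → MinαAtLeast G m → t ≤ suc m → 5 * m + t ≤ n →
    ∃ λ I → ∣ I ∣ ≡ t × Removable G m I
  removable {m} minα t≤1+m 5m+t≤n with any? (λ w → 2 * m + 4 ℕₚ.<? ∣ N w ∣)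
  ... | yes (w₀ , 2m+4<deg) = highDegree-removable minα 2m+4<deg t≤1+m
  ... | no no-high = lowDegree-removable (λ w → ℕₚ.≮⇒≥ (λ 2m+4<deg → no-high (w , 2m+4<deg))) t≤1+m 5m+t≤n

open NonCrossingGraph using (removable)

-- From s − 1 to s colors

nonCrossingClaim-step : ∀ d → 4 ≤ d → NonCrossingClaim (suc d) → NonCrossingClaim (2 + d)
nonCrossingClaim-step d 4≤d claim n G nc minα
  with removable G nc minα (⌈n/s⌉≤1+⌊n/s⌋ n (suc d)) (5*⌊n/s⌋+⌈n/s⌉≤n n 4≤d)
... | I , ∣I∣≡t , I-indep , keeps-α =
  freshClass-equitable G I I-indep coloring (ℕₚ.≤-reflexive (sym ⌊n′/s′⌋≡m)) ⌈n′/s′⌉≤t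
    (≤-trans (⌊n/s⌋≤⌈n/s⌉ n (suc d)) (ℕₚ.≤-reflexive (sym ∣I∣≡t))) (ℕₚ.≤-reflexive ∣I∣≡t)
  where
  ∣∁I∣≡n∸t : ∣ ∁ I ∣ ≡ n ∸ ⌈ n / 2 + d ⌉
  ∣∁I∣≡n∸t = trans (∣∁p∣≡n∸∣p∣ I) (cong (n ∸_) ∣I∣≡t)

  ⌊n′/s′⌋≡m : ⌊ ∣ ∁ I ∣ / suc d ⌋ ≡ ⌊ n / 2 + d ⌋
  ⌊n′/s′⌋≡m = trans (cong (λ x → ⌊ x / suc d ⌋) ∣∁I∣≡n∸t) (⌊[n∸⌈n/s⌉]/[s∸1]⌋≡⌊n/s⌋ n d)

  ⌈n′/s′⌉≤t : ⌈ ∣ ∁ I ∣ / suc d ⌉ ≤ ⌈ n / 2 + d ⌉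
  ⌈n′/s′⌉≤t = subst (λ x → ⌈ x / suc d ⌉ ≤ ⌈ n / 2 + d ⌉) (sym ∣∁I∣≡n∸t) (⌈[n∸⌈n/s⌉]/[s∸1]⌉≤⌈n/s⌉ n d)

  coloring : HasEquitableColoring (induced G (∁ I)) (suc d)
  coloring = claim ∣ ∁ I ∣ (induced G (∁ I)) (induced-nonCrossing G (∁ I) nc)
    (subst (MinαAtLeast (induced G (∁ I))) (sym ⌊n′/s′⌋≡m) (induced-minα G (∁ I) keeps-α))

claim-step : ∀ s → 6 ≤ s → Claim (s ∸ 1) → Claim s
claim-step (suc (suc d)) (s≤s (s≤s 4≤d)) claim =
  nonCrossingClaim⇒claim (2 + d)
    (nonCrossingClaim-step d 4≤d (λ n G nc → claim n G (nonCrossing⇒outerplanar {G = G} nc)))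

claim-upward : ∀ s₀ → 5 ≤ s₀ → Claim s₀ → ∀ s → s₀ ≤ s → Claim s
claim-upward s₀ 5≤s₀ claim zero s₀≤0 with () ← ≤-trans 5≤s₀ s₀≤0
claim-upward s₀ 5≤s₀ claim (suc s) s₀≤1+s with s₀ ℕₚ.≟ suc s
... | yes refl = claim
... | no s₀≢1+s = claim-step (suc s) (s≤s (≤-trans 5≤s₀ s₀≤s)) (claim-upward s₀ 5≤s₀ claim s s₀≤s)
  where
  s₀≤s : s₀ ≤ s
  s₀≤s = ℕₚ.≤-pred (ℕₚ.≤∧≢⇒< s₀≤1+s s₀≢1+s)

lemma7 : (∀ (s : ℕ) → 6 ≤ s → Claim (s ∸ 1) → Claim s)
    × (∀ (s₀ : ℕ) → 5 ≤ s₀ → Claim s₀ → ∀ (s : ℕ) → s₀ ≤ s → Claim s)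
lemma7 = claim-step , claim-upward
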